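{- Let $G=(V,E)$ be a graph. Then: (i) $d_\Delta(G)\ge\alpha(G)$; (ii) if $S\subseteq V$ is convexly independent, then no three vertices of $S$ form a $K_3$ (triangle) in $G$; (iii) if every two adjacent vertices $u,v$ of $G$ form a hull set (i.e. $\langle\{u,v\}\rangle=V$), then $d_\Delta(G)=\max\{2,\alpha(G)\}$.
   Context: All graphs are finite, simple, undirected and connected. $\alpha(G)$ is the independence number of $G$. For $S\subseteq V$, the $\Delta$-interval $[S]$ is the set consisting of all vertices of $S$ together with every vertex $v\in V$ adjacent to both $x$ and $y$ for some pair of adjacent vertices $x,y\in S$. A set $S$ is $\Delta$-convex if $[S]=S$, and $\langle S\rangle$ denotes the smallest $\Delta$-convex set containing $S$ ($\langle\emptyset\rangle=\emptyset$). A set $S$ is convexly independent if $a\notin\langle S\setminus\{a\}\rangle$ for every $a\in S$. The rank $d_\Delta(G)$ is the least integer $n\ge0$ such that every $S\subseteq V$ with $|S|>n$ is not convexly independent (equivalently, the maximum size of a convexly independent set). -}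

module Defs where

open import Data.Nat using (ℕ; _≤_; _<_; _⊔_)
open import Data.Fin using (Fin)
open import Data.Fin.Subset using (Subset; _∈_; _⊆_; ∣_∣; ⁅_⁆; _∪_; _-_)
open import Data.Product using (Σ; ∃; _×_; _,_)
open import Data.Sum using (_⊎_)
open import Relation.Nullary using (¬_)
open import Relation.Binary.PropositionalEquality using (_≡_)
open import Relation.Binary using (Decidable)
open import Relation.Binary.Construct.Closure.ReflexiveTransitive using (Star)

record Graph : Set₁ where
  field
    n       : ℕ
    _~_     : Fin n → Fin n → Set
    ~-dec   : Decidable _~_
    ~-sym   : ∀ {x y} → x ~ y → y ~ x
    ~-irrefl : ∀ {x} → ¬ (x ~ x)

module _ (G : Graph) where
  open Graph G

  Connected : Set
  Connected = ∀ x y → Star _~_ x y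

  Independent : Subset n → Set
  Independent S = ∀ x y → x ∈ S → y ∈ S → ¬ (x ~ y)

  IsIndependenceNumber : ℕ → Set
  IsIndependenceNumber a =
    (Σ (Subset n) λ S → Independent S × ∣ S ∣ ≡ a) × (∀ S → Independent S → ∣ S ∣ ≤ a)

  InInterval : Subset n → Fin n → Set
  InInterval S v = v ∈ S ⊎ (Σ (Fin n) λ x → Σ (Fin n) λ y →
                     x ∈ S × y ∈ S × x ~ y × v ~ x × v ~ y)

  -- S is Δ-convex: [S] = S  (S ⊆ [S] always holds)
  Convex : Subset n → Set
  Convex S = ∀ v → InInterval S v → v ∈ S

  InHull : Subset n → Fin n → Set
  InHull S v = ∀ T → Convex T → S ⊆ T → v ∈ T

  ConvexlyIndependent : Subset n → Set
  ConvexlyIndependent S = ∀ a → a ∈ S → ¬ InHull (S - a) a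

  RankBound : ℕ → Set
  RankBound m = ∀ S → m < ∣ S ∣ → ¬ ConvexlyIndependent S

  IsRank : ℕ → Set
  IsRank d = RankBound d × (∀ m → RankBound m → d ≤ m)

  HullSet₂ : Fin n → Fin n → Set
  HullSet₂ u v = ∀ w → InHull (⁅ u ⁆ ∪ ⁅ v ⁆) w

-- Independent sets are Δ-convex, and so is any set of at most one vertex; hence
-- independent sets and vertex pairs are convexly independent, giving α ≤ d and 2 ≤ d.
-- A triangle xyz inside S puts z in the interval [S - z].  If every edge is a hull
-- set, a convexly independent S containing an edge xy has no third vertex z, since
-- ⟨S - z⟩ ⊇ ⟨{x, y}⟩ = V; so S is independent or has at most two vertices.
module Submission where

open import Defs
open import Data.Nat using (ℕ; _≤_; _+_; _⊔_; z≤n; s≤s)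
open import Data.Nat.Properties
  using (≤-trans; ≤-reflexive; ≤-antisym; ≮⇒≥; +-suc; m≤n⇒m≤1+n; m≤n⇒m≤n⊔o; m≤n⇒m≤o⊔n; ⊔-lub; <⇒≱)
open import Data.Fin using (Fin; zero; suc)
open import Data.Fin.Subset using (Subset; _∈_; _∉_; _⊆_; ∣_∣; ⁅_⁆; _∪_; _-_; inside; outside)
open import Data.Fin.Subset.Properties
  using (x∈⁅x⁆; x∈⁅y⁆⇒x≡y; ∣⁅x⁆∣≡1; x∈p∪q⁻; p─q⊆p; x∈p∧x≢y⇒x∈p-y; _∈?_; p⊆q⇒∣p∣≤∣q∣)
open import Data.Vec using (_∷_; []; there)
open import Data.Product using (Σ; _×_; _,_)
open import Data.Sum using (_⊎_; inj₁; inj₂)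
open import Data.Empty using (⊥; ⊥-elim)
open import Relation.Nullary using (¬_; yes; no)
open import Relation.Binary.PropositionalEquality using (_≡_; refl; sym; cong₂)

x∉p-x : ∀ {n} (p : Subset n) (x : Fin n) → x ∉ p - x
x∉p-x (_ ∷ p)       zero    ()
x∉p-x (outside ∷ p) (suc x) (there x∈) = x∉p-x p x x∈
x∉p-x (inside ∷ p)  (suc x) (there x∈) = x∉p-x p x x∈

∣p∪q∣≤∣p∣+∣q∣ : ∀ {n} (p q : Subset n) → ∣ p ∪ q ∣ ≤ ∣ p ∣ + ∣ q ∣
∣p∪q∣≤∣p∣+∣q∣ []            []            = z≤n
∣p∪q∣≤∣p∣+∣q∣ (outside ∷ p) (outside ∷ q) = ∣p∪q∣≤∣p∣+∣q∣ p q
∣p∪q∣≤∣p∣+∣q∣ (outside ∷ p) (inside ∷ q)  =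
  ≤-trans (s≤s (∣p∪q∣≤∣p∣+∣q∣ p q)) (≤-reflexive (sym (+-suc ∣ p ∣ ∣ q ∣)))
∣p∪q∣≤∣p∣+∣q∣ (inside ∷ p)  (outside ∷ q) = s≤s (∣p∪q∣≤∣p∣+∣q∣ p q)
∣p∪q∣≤∣p∣+∣q∣ (inside ∷ p)  (inside ∷ q)  =
  s≤s (≤-trans (m≤n⇒m≤1+n (∣p∪q∣≤∣p∣+∣q∣ p q)) (≤-reflexive (sym (+-suc ∣ p ∣ ∣ q ∣))))

∣⁅x⁆∪⁅y⁆∣≤2 : ∀ {n} (x y : Fin n) → ∣ ⁅ x ⁆ ∪ ⁅ y ⁆ ∣ ≤ 2
∣⁅x⁆∪⁅y⁆∣≤2 x y =
  ≤-trans (∣p∪q∣≤∣p∣+∣q∣ ⁅ x ⁆ ⁅ y ⁆) (≤-reflexive (cong₂ _+_ (∣⁅x⁆∣≡1 x) (∣⁅x⁆∣≡1 y)))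

x∈⁅y⁆∪⁅z⁆⁻ : ∀ {n} {x y z : Fin n} → x ∈ ⁅ y ⁆ ∪ ⁅ z ⁆ → x ≡ y ⊎ x ≡ z
x∈⁅y⁆∪⁅z⁆⁻ {y = y} {z} x∈ with x∈p∪q⁻ ⁅ y ⁆ ⁅ z ⁆ x∈
... | inj₁ x∈⁅y⁆ = inj₁ (x∈⁅y⁆⇒x≡y y x∈⁅y⁆)
... | inj₂ x∈⁅z⁆ = inj₂ (x∈⁅y⁆⇒x≡y z x∈⁅z⁆)

x∈p-y⇒x≢y : ∀ {n} {p : Subset n} {x y} → x ∈ p - y → ¬ x ≡ y
x∈p-y⇒x≢y {p = p} x∈ refl = x∉p-x p _ x∈

⁅x⁆∪⁅y⁆-z⊆⁅w⁆ : ∀ {n} {x y : Fin n} z → z ∈ ⁅ x ⁆ ∪ ⁅ y ⁆ →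
                Σ (Fin n) λ w → (⁅ x ⁆ ∪ ⁅ y ⁆) - z ⊆ ⁅ w ⁆
⁅x⁆∪⁅y⁆-z⊆⁅w⁆ {x = x} {y} z z∈ with x∈⁅y⁆∪⁅z⁆⁻ z∈
... | inj₁ refl = y , λ v∈ → the-other v∈ (x∈⁅y⁆∪⁅z⁆⁻ (p─q⊆p _ _ v∈))
  where
  the-other : ∀ {v} → v ∈ (⁅ x ⁆ ∪ ⁅ y ⁆) - x → v ≡ x ⊎ v ≡ y → v ∈ ⁅ y ⁆
  the-other v∈ (inj₁ v≡x)  = ⊥-elim (x∈p-y⇒x≢y v∈ v≡x)
  the-other _  (inj₂ refl) = x∈⁅x⁆ y
... | inj₂ refl = x , λ v∈ → the-other v∈ (x∈⁅y⁆∪⁅z⁆⁻ (p─q⊆p _ _ v∈))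
  where
  the-other : ∀ {v} → v ∈ (⁅ x ⁆ ∪ ⁅ y ⁆) - y → v ≡ x ⊎ v ≡ y → v ∈ ⁅ x ⁆
  the-other _  (inj₁ refl) = x∈⁅x⁆ x
  the-other v∈ (inj₂ v≡y)  = ⊥-elim (x∈p-y⇒x≢y v∈ v≡y)

⁅x⁆∪⁅y⁆⊆p : ∀ {n} {p : Subset n} {x y} → x ∈ p → y ∈ p → ⁅ x ⁆ ∪ ⁅ y ⁆ ⊆ p
⁅x⁆∪⁅y⁆⊆p x∈ y∈ z∈ with x∈⁅y⁆∪⁅z⁆⁻ z∈
... | inj₁ refl = x∈
... | inj₂ refl = y∈

pair-of-size-2 : ∀ {n} → 2 ≤ n → Σ (Fin n) λ x → Σ (Fin n) λ y → 2 ≤ ∣ ⁅ x ⁆ ∪ ⁅ y ⁆ ∣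
pair-of-size-2 (s≤s (s≤s _)) = zero , suc zero , s≤s (s≤s z≤n)

module _ (G : Graph) where
  open Graph G

  Independent-⊆ : ∀ {S T} → S ⊆ T → Independent G T → Independent G S
  Independent-⊆ S⊆T indT x y x∈ y∈ = indT x y (S⊆T x∈) (S⊆T y∈)

  Independent-⁅⁆ : ∀ v → Independent G ⁅ v ⁆
  Independent-⁅⁆ v x y x∈ y∈ x~y
    with refl ← x∈⁅y⁆⇒x≡y v x∈ | refl ← x∈⁅y⁆⇒x≡y v y∈ = ~-irrefl x~y

  Independent⇒Convex : ∀ {S} → Independent G S → Convex G S
  Independent⇒Convex indS v (inj₁ v∈S)                        = v∈S
  Independent⇒Convex indS v (inj₂ (x , y , x∈ , y∈ , x~y , _)) = ⊥-elim (indS x y x∈ y∈ x~y)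

  InInterval⇒InHull : ∀ {S v} → InInterval G S v → InHull G S v
  InInterval⇒InHull (inj₁ v∈S) T convT S⊆T = S⊆T v∈S
  InInterval⇒InHull (inj₂ (x , y , x∈ , y∈ , x~y , v~x , v~y)) T convT S⊆T =
    convT _ (inj₂ (x , y , S⊆T x∈ , S⊆T y∈ , x~y , v~x , v~y))

  InHull-mono : ∀ {S S′ v} → S ⊆ S′ → InHull G S v → InHull G S′ v
  InHull-mono S⊆S′ v∈⟨S⟩ T convT S′⊆T = v∈⟨S⟩ T convT (λ x∈ → S′⊆T (S⊆S′ x∈))

  Convex-deletions⇒ConvexlyIndependent :
    ∀ {S} → (∀ a → a ∈ S → Convex G (S - a)) → ConvexlyIndependent G S
  Convex-deletions⇒ConvexlyIndependent {S} conv a a∈S a∈⟨S-a⟩ =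
    x∉p-x S a (a∈⟨S-a⟩ (S - a) (conv a a∈S) (λ x∈ → x∈))

  Independent⇒ConvexlyIndependent : ∀ {S} → Independent G S → ConvexlyIndependent G S
  Independent⇒ConvexlyIndependent {S} indS = Convex-deletions⇒ConvexlyIndependent λ a _ →
    Independent⇒Convex (Independent-⊆ (p─q⊆p S ⁅ a ⁆) indS)

  ⁅x⁆∪⁅y⁆-ConvexlyIndependent : ∀ x y → ConvexlyIndependent G (⁅ x ⁆ ∪ ⁅ y ⁆)
  ⁅x⁆∪⁅y⁆-ConvexlyIndependent x y = Convex-deletions⇒ConvexlyIndependent λ z z∈ →
    let (w , ⊆⁅w⁆) = ⁅x⁆∪⁅y⁆-z⊆⁅w⁆ z z∈ in
    Independent⇒Convex (Independent-⊆ ⊆⁅w⁆ (Independent-⁅⁆ w))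

  ~⇒≢ : ∀ {x y} → x ~ y → ¬ x ≡ y
  ~⇒≢ x~y refl = ~-irrefl x~y

  ConvexlyIndependent-triangle-free :
    ∀ S → ConvexlyIndependent G S → ∀ x y z → x ∈ S → y ∈ S → z ∈ S →
    x ~ y → y ~ z → x ~ z → ⊥
  ConvexlyIndependent-triangle-free S ci x y z x∈ y∈ z∈ x~y y~z x~z = ci z z∈ (InInterval⇒InHull
    (inj₂ (x , y , x∈p∧x≢y⇒x∈p-y x∈ (~⇒≢ x~z) , x∈p∧x≢y⇒x∈p-y y∈ (~⇒≢ y~z) ,
           x~y , ~-sym x~z , ~-sym y~z)))

  α≤RankBound : ∀ {a m} → IsIndependenceNumber G a → RankBound G m → a ≤ m
  α≤RankBound ((S , indS , refl) , _) rb =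
    ≮⇒≥ λ m<∣S∣ → rb S m<∣S∣ (Independent⇒ConvexlyIndependent indS)

  2≤RankBound : ∀ {m} → 2 ≤ n → RankBound G m → 2 ≤ m
  2≤RankBound 2≤n rb with (x , y , 2≤∣⁅x⁆∪⁅y⁆∣) ← pair-of-size-2 2≤n =
    ≮⇒≥ λ m<2 → rb (⁅ x ⁆ ∪ ⁅ y ⁆) (≤-trans m<2 2≤∣⁅x⁆∪⁅y⁆∣) (⁅x⁆∪⁅y⁆-ConvexlyIndependent x y)

  module _ (edges-hull : ∀ u v → u ~ v → HullSet₂ G u v) where

    ConvexlyIndependent-edge⇒⊆ : ∀ {S} → ConvexlyIndependent G S →
      ∀ {x y} → x ∈ S → y ∈ S → x ~ y → S ⊆ ⁅ x ⁆ ∪ ⁅ y ⁆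
    ConvexlyIndependent-edge⇒⊆ {S} ci {x} {y} x∈ y∈ x~y {z} z∈ with z ∈? ⁅ x ⁆ ∪ ⁅ y ⁆
    ... | yes z∈xy = z∈xy
    ... | no  z∉xy = ⊥-elim (ci z z∈ (InHull-mono xy⊆S-z (edges-hull x y x~y z)))
      where
      xy⊆S-z : ⁅ x ⁆ ∪ ⁅ y ⁆ ⊆ S - z
      xy⊆S-z w∈ = x∈p∧x≢y⇒x∈p-y (⁅x⁆∪⁅y⁆⊆p x∈ y∈ w∈) λ { refl → z∉xy w∈ }

    RankBound-2⊔α : ∀ {a} → IsIndependenceNumber G a → RankBound G (2 ⊔ a)
    RankBound-2⊔α {a} (_ , maximal) S 2⊔a<∣S∣ ci =
      <⇒≱ 2⊔a<∣S∣ (m≤n⇒m≤o⊔n 2 (maximal S independent))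
      where
      independent : Independent G S
      independent x y x∈ y∈ x~y = <⇒≱ 2⊔a<∣S∣ (m≤n⇒m≤n⊔o a (≤-trans
        (p⊆q⇒∣p∣≤∣q∣ (ConvexlyIndependent-edge⇒⊆ ci x∈ y∈ x~y)) (∣⁅x⁆∪⁅y⁆∣≤2 x y)))

lemma4 : (G : Graph) → Connected G → (d a : ℕ) → IsRank G d → IsIndependenceNumber G a →
    (a ≤ d)
    × (∀ (S : Subset (Graph.n G)) → ConvexlyIndependent G S →
         ∀ x y z → x ∈ S → y ∈ S → z ∈ S →
         Graph._~_ G x y → Graph._~_ G y z → Graph._~_ G x z → ⊥)
    × (2 ≤ Graph.n G →
       (∀ u v → Graph._~_ G u v → HullSet₂ G u v) →
       d ≡ 2 ⊔ a)
lemma4 G _ d a (d-bound , d-least) α =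
  α≤RankBound G α d-bound ,
  ConvexlyIndependent-triangle-free G ,
  λ 2≤n edges-hull → ≤-antisym
    (d-least (2 ⊔ a) (RankBound-2⊔α G edges-hull α))
    (⊔-lub (2≤RankBound G 2≤n d-bound) (α≤RankBound G α d-bound))
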